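{- Let $a,b,c$ be positive integers, let $w_0,w_1$ be arbitrary, and let $\{w_n\}$ be defined by $w_n=aw_{n-1}+cw_{n-2}$ for $n\ge2$ even and $w_n=bw_{n-1}+cw_{n-2}$ for $n\ge2$ odd. Let $\{v_n\}$ satisfy the same recurrence with $v_0=2$, $v_1=b$. Then for integers $n,m,r>0$, $$-(-c)^{m+r}w_n+(-c)^m\left(\frac ab\right)^{\xi(r)\xi(n+1)}v_r\,w_{r+n}+w_{2(m+r)+n}=\left(\frac ab\right)^{\xi(m)\xi(n+1)}v_m\,w_{m+2r+n}.$$
   Context: $\xi(n)=n-2\lfloor n/2\rfloor$ is the parity function.
   Formalization: The initial values $w_0,w_1$ are taken to be rational numbers. -}

module Defs where

open import Data.Nat as ℕ using (ℕ; zero; suc; _∸_; _/_)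
open import Data.Integer using (+_)
open import Data.Rational using (ℚ; 1ℚ; _+_; _*_; -_)
import Data.Rational as ℚ

ξ : ℕ → ℕ
ξ n = n ∸ 2 ℕ.* (n / 2)

_^_ : ℚ → ℕ → ℚ
x ^ zero = 1ℚ
x ^ suc k = x * (x ^ k)

infixr 8 _^_

ℕ→ℚ : ℕ → ℚ
ℕ→ℚ k = + k ℚ./ 1

pick : ℕ → ℚ → ℚ → ℚ
pick zero x y = x
pick (suc _) x y = y

seqW : (a b c : ℕ) (w0 w1 : ℚ) → ℕ → ℚ
seqW a b c w0 w1 zero = w0
seqW a b c w0 w1 (suc zero) = w1
seqW a b c w0 w1 (suc (suc n)) =
  pick (ξ (suc (suc n))) (ℕ→ℚ a) (ℕ→ℚ b) * seqW a b c w0 w1 (suc n)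
  + ℕ→ℚ c * seqW a b c w0 w1 n

{-# OPTIONS --safe #-}
-- The core is the product formula
--   (a/b)^(ξ(m)ξ(n+1)) v_m w_(m+n) = w_(2m+n) + (-c)^m w_n,
-- proved by two-step induction on m. Since v satisfies the same recurrence as w, expanding
-- v_(m+2) leaves the coefficient chosen by the parity of m, whereas w needs the one chosen by
-- the parity of n; the power of a/b is exactly the factor that trades one for the other.
-- The theorem is the product formula for (m, n + 2r) combined with (-c)^m times the one for (r, n).
module Submission where

open import Defs
open import Data.Nat using (ℕ; NonZero; _<_; suc; zero; s≤s; z≤n)
import Data.Nat as ℕ
open import Data.Nat.Properties using (+-suc; *-distribˡ-+)
open import Data.Nat.DivMod using (m/n≡1+[m∸n]/n)
open import Data.Nat.Tactic.RingSolver using (solve-∀)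
open import Data.Integer using (+_)
import Data.Integer.Properties as ℤ
open import Data.Rational using (ℚ; _+_; _*_; -_; _/_; 1ℚ; toℚᵘ)
open import Data.Rational.Properties
  using (*-assoc; *-comm; *-identityˡ; *-identityʳ; toℚᵘ-injective; toℚᵘ-homo-*; toℚᵘ-fromℚᵘ)
open import Data.Rational.Solver using (module +-*-Solver)
import Data.Rational.Unnormalised as ℚᵘ
import Data.Rational.Unnormalised.Properties as ℚᵘ
open import Data.Product using (_×_; _,_)
open import Data.Sum using (_⊎_; inj₁; inj₂)
open import Relation.Binary.PropositionalEquality
  using (_≡_; refl; sym; trans; cong; cong₂; module ≡-Reasoning)

open +-*-Solver using (solve; _:=_; con; _:+_; _:*_; :-_)

ξ-suc-suc : ∀ n → ξ (suc (suc n)) ≡ ξ n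
ξ-suc-suc n = cong (suc (suc n) ℕ.∸_)
  (trans (cong (2 ℕ.*_) (m/n≡1+[m∸n]/n {suc (suc n)} {2} (s≤s (s≤s z≤n))))
         (*-distribˡ-+ 2 1 (n ℕ./ 2)))

Alternating : ℕ → ℕ → Set
Alternating x x′ = (x ≡ 0 × x′ ≡ 1) ⊎ (x ≡ 1 × x′ ≡ 0)

ξ-alternates : ∀ n → Alternating (ξ n) (ξ (suc n))
ξ-alternates zero = inj₁ (refl , refl)
ξ-alternates (suc n) with ξ-alternates n
... | inj₁ (ξn≡0 , ξ1+n≡1) = inj₂ (ξ1+n≡1 , trans (ξ-suc-suc n) ξn≡0)
... | inj₂ (ξn≡1 , ξ1+n≡0) = inj₁ (ξ1+n≡0 , trans (ξ-suc-suc n) ξn≡1)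

ξ-+-double : ∀ k n → ξ (k ℕ.+ (k ℕ.+ n)) ≡ ξ n
ξ-+-double zero    n = refl
ξ-+-double (suc k) n = begin
  ξ (suc (k ℕ.+ suc (k ℕ.+ n))) ≡⟨ cong (λ i → ξ (suc i)) (+-suc k (k ℕ.+ n)) ⟩
  ξ (suc (suc (k ℕ.+ (k ℕ.+ n)))) ≡⟨ ξ-suc-suc (k ℕ.+ (k ℕ.+ n)) ⟩
  ξ (k ℕ.+ (k ℕ.+ n))             ≡⟨ ξ-+-double k n ⟩
  ξ n                             ∎
  where open ≡-Reasoning

+-suc-suc : ∀ m n → m ℕ.+ suc (suc n) ≡ suc (suc (m ℕ.+ n))
+-suc-suc m n = trans (+-suc m (suc n)) (cong suc (+-suc m n))

+-double-suc : ∀ k n → k ℕ.+ (k ℕ.+ suc n) ≡ suc (k ℕ.+ (k ℕ.+ n))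
+-double-suc k n = trans (cong (k ℕ.+_) (+-suc k n)) (+-suc k (k ℕ.+ n))

^-homo-* : ∀ x m n → x ^ (m ℕ.+ n) ≡ x ^ m * x ^ n
^-homo-* x zero    n = sym (*-identityˡ (x ^ n))
^-homo-* x (suc m) n = begin
  x * x ^ (m ℕ.+ n)     ≡⟨ cong (x *_) (^-homo-* x m n) ⟩
  x * (x ^ m * x ^ n)   ≡⟨ sym (*-assoc x (x ^ m) (x ^ n)) ⟩
  x * x ^ m * x ^ n     ∎
  where open ≡-Reasoning

a/b*b≡a : ∀ a b .{{_ : NonZero b}} → (+ a / b) * ℕ→ℚ b ≡ ℕ→ℚ a
a/b*b≡a a (suc b) = toℚᵘ-injective (begin
  toℚᵘ ((+ a / suc b) * ℕ→ℚ (suc b))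
    ≈⟨ toℚᵘ-homo-* (+ a / suc b) (ℕ→ℚ (suc b)) ⟩
  toℚᵘ (+ a / suc b) ℚᵘ.* toℚᵘ (ℕ→ℚ (suc b))
    ≈⟨ ℚᵘ.*-cong (toℚᵘ-fromℚᵘ (ℚᵘ.mkℚᵘ (+ a) b)) (toℚᵘ-fromℚᵘ (ℚᵘ.mkℚᵘ (+ suc b) 0)) ⟩
  ℚᵘ.mkℚᵘ (+ a) b ℚᵘ.* ℚᵘ.mkℚᵘ (+ suc b) 0
    ≈⟨ ℚᵘ.*≡* (ℤ.*-assoc (+ a) (+ suc b) (+ 1)) ⟩
  ℚᵘ.mkℚᵘ (+ a) 0
    ≈⟨ ℚᵘ.≃-sym (toℚᵘ-fromℚᵘ (ℚᵘ.mkℚᵘ (+ a) 0)) ⟩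
  toℚᵘ (ℕ→ℚ a) ∎)
  where open ℚᵘ.≃-Reasoning

module _ (a b : ℕ) .{{_ : NonZero b}} where

  coeff : ℕ → ℚ
  coeff k = pick (ξ k) (ℕ→ℚ a) (ℕ→ℚ b)

  twist : ℕ → ℕ → ℚ
  twist m n = (+ a / b) ^ (ξ m ℕ.* ξ (suc n))

  twist-periodicˡ : ∀ m n → twist (suc (suc m)) n ≡ twist m n
  twist-periodicˡ m n = cong (λ k → (+ a / b) ^ (k ℕ.* ξ (suc n))) (ξ-suc-suc m)

  twist-periodicʳ : ∀ m n → twist m (suc (suc n)) ≡ twist m n
  twist-periodicʳ m n = cong (λ k → (+ a / b) ^ (ξ m ℕ.* k)) (ξ-suc-suc (suc n))

  twist-+-doubleʳ : ∀ m k n → twist m (k ℕ.+ (k ℕ.+ n)) ≡ twist m n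
  twist-+-doubleʳ m k n = cong (λ i → (+ a / b) ^ (ξ m ℕ.* i))
    (trans (cong ξ (sym (+-double-suc k n))) (ξ-+-double k (suc n)))

  twist-coeff : ∀ m n → twist m n * coeff m ≡ coeff n * twist (suc m) (suc n)
  twist-coeff m n = begin
    twist m n * coeff m
      ≡⟨ on-bits (ξ-alternates m) (ξ-alternates n) ⟩
    coeff n * (+ a / b) ^ (ξ (suc m) ℕ.* ξ n)
      ≡⟨ cong (λ k → coeff n * (+ a / b) ^ (ξ (suc m) ℕ.* k)) (sym (ξ-suc-suc n)) ⟩
    coeff n * twist (suc m) (suc n) ∎
    where
    open ≡-Reasoning
    A = ℕ→ℚ a
    B = ℕ→ℚ b
    a/b*1*b≡a : (+ a / b) * 1ℚ * B ≡ A
    a/b*1*b≡a = trans (cong (_* B) (*-identityʳ (+ a / b))) (a/b*b≡a a b)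
    on-bits : ∀ {x x′ y y′} → Alternating x x′ → Alternating y y′ →
              (+ a / b) ^ (x ℕ.* y′) * pick x A B ≡ pick y A B * (+ a / b) ^ (x′ ℕ.* y)
    on-bits (inj₁ (refl , refl)) (inj₁ (refl , refl)) = *-comm 1ℚ A
    on-bits (inj₁ (refl , refl)) (inj₂ (refl , refl)) = begin
      1ℚ * A                 ≡⟨ *-identityˡ A ⟩
      A                      ≡⟨ sym a/b*1*b≡a ⟩
      (+ a / b) * 1ℚ * B     ≡⟨ *-comm ((+ a / b) * 1ℚ) B ⟩
      B * ((+ a / b) * 1ℚ)   ∎
    on-bits (inj₂ (refl , refl)) (inj₁ (refl , refl)) = trans a/b*1*b≡a (sym (*-identityʳ A))
    on-bits (inj₂ (refl , refl)) (inj₂ (refl , refl)) = *-comm 1ℚ B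

  -- twist 2 (suc n) computes to 1ℚ, as ξ 2 = 0.
  twist-one : ∀ n → twist 1 n * ℕ→ℚ b ≡ coeff n
  twist-one n = trans (twist-coeff 1 n) (*-identityʳ (coeff n))

  module _ (c : ℕ) where

    private
      C : ℚ
      C = ℕ→ℚ c

    seqW-suc-suc : ∀ w0 w1 k → seqW a b c w0 w1 (suc (suc k))
                   ≡ coeff k * seqW a b c w0 w1 (suc k) + C * seqW a b c w0 w1 k
    seqW-suc-suc w0 w1 k =
      cong (λ i → pick i (ℕ→ℚ a) (ℕ→ℚ b) * seqW a b c w0 w1 (suc k) + C * seqW a b c w0 w1 k)
           (ξ-suc-suc k)

    v : ℕ → ℚ
    v = seqW a b c (ℕ→ℚ 2) (ℕ→ℚ b)

    module _ (w0 w1 : ℚ) where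

      w : ℕ → ℚ
      w = seqW a b c w0 w1

      ProductFormula : ℕ → Set
      ProductFormula m =
        ∀ n → twist m n * v m * w (m ℕ.+ n) ≡ w (m ℕ.+ (m ℕ.+ n)) + (- C) ^ m * w n

      product-formula-zero : ProductFormula 0
      product-formula-zero n =
        solve 1 (λ x → con 1ℚ :* (con 1ℚ :+ con 1ℚ) :* x := x :+ con 1ℚ :* x) refl (w n)

      product-formula-one : ProductFormula 1
      product-formula-one n = begin
        twist 1 n * ℕ→ℚ b * w (suc n)
          ≡⟨ cong (_* w (suc n)) (twist-one n) ⟩
        coeff n * w (suc n)
          ≡⟨ solve 4 (λ p x C y → p :* x := (p :* x :+ C :* y) :+ ((:- C) :* con 1ℚ) :* y)
               refl (coeff n) (w (suc n)) C (w n) ⟩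
        (coeff n * w (suc n) + C * w n) + (- C) ^ 1 * w n
          ≡⟨ cong (_+ (- C) ^ 1 * w n) (sym (seqW-suc-suc w0 w1 n)) ⟩
        w (suc (suc n)) + (- C) ^ 1 * w n ∎
        where open ≡-Reasoning

      product-formula-step : ∀ m → ProductFormula m → ProductFormula (suc m) →
                             ProductFormula (2 ℕ.+ m)
      product-formula-step m pf[m] pf[1+m] n = begin
        twist (2 ℕ.+ m) n * v (2 ℕ.+ m) * W
          ≡⟨ cong₂ (λ x y → x * y * W) (twist-periodicˡ m n) (seqW-suc-suc (ℕ→ℚ 2) (ℕ→ℚ b) m) ⟩
        twist m n * (coeff m * v′ + C * v m) * W
          ≡⟨ solve 6 (λ s p u C x W → s :* (p :* u :+ C :* x) :* W
                                   := (s :* p) :* u :* W :+ C :* (s :* x :* W))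
               refl (twist m n) (coeff m) v′ C (v m) W ⟩
        twist m n * coeff m * v′ * W + C * (twist m n * v m * W)
          ≡⟨ cong₂ (λ x y → x * v′ * W + C * y) (twist-coeff m n) IH₀ ⟩
        coeff n * twist′ * v′ * W + C * (w₂ + t * w (2 ℕ.+ n))
          ≡⟨ cong (_+ C * (w₂ + t * w (2 ℕ.+ n)))
               (solve 4 (λ p s u W → p :* s :* u :* W := p :* (s :* u :* W))
                  refl (coeff n) twist′ v′ W) ⟩
        coeff n * (twist′ * v′ * W) + C * (w₂ + t * w (2 ℕ.+ n))
          ≡⟨ cong₂ (λ x y → coeff n * x + C * (w₂ + t * y)) IH₁ (seqW-suc-suc w0 w1 n) ⟩
        coeff n * (w₃ + (- C) * t * w (1 ℕ.+ n))
          + C * (w₂ + t * (coeff n * w (1 ℕ.+ n) + C * w n))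
          ≡⟨ solve 7 (λ p x₃ C t y₁ x₂ y₀ →
                  p :* (x₃ :+ (:- C) :* t :* y₁) :+ C :* (x₂ :+ t :* (p :* y₁ :+ C :* y₀))
               := (p :* x₃ :+ C :* x₂) :+ (:- C) :* ((:- C) :* t) :* y₀)
               refl (coeff n) w₃ C t (w (1 ℕ.+ n)) w₂ (w n) ⟩
        (coeff n * w₃ + C * w₂) + (- C) ^ (2 ℕ.+ m) * w n
          ≡⟨ cong (_+ (- C) ^ (2 ℕ.+ m) * w n) (sym w[4+K]) ⟩
        w (4 ℕ.+ K) + (- C) ^ (2 ℕ.+ m) * w n
          ≡⟨ cong (λ i → w (2 ℕ.+ i) + (- C) ^ (2 ℕ.+ m) * w n) (sym (+-suc-suc m (m ℕ.+ n))) ⟩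
        w (2 ℕ.+ m ℕ.+ (2 ℕ.+ m ℕ.+ n)) + (- C) ^ (2 ℕ.+ m) * w n ∎
        where
        open ≡-Reasoning
        t = (- C) ^ m
        K = m ℕ.+ (m ℕ.+ n)
        W = w (2 ℕ.+ (m ℕ.+ n))
        w₂ = w (2 ℕ.+ K)
        w₃ = w (3 ℕ.+ K)
        v′ = v (1 ℕ.+ m)
        twist′ = twist (1 ℕ.+ m) (1 ℕ.+ n)
        IH₀ : twist m n * v m * W ≡ w₂ + t * w (2 ℕ.+ n)
        IH₀ = begin
          twist m n * v m * W
            ≡⟨ cong₂ (λ x i → x * v m * w i) (sym (twist-periodicʳ m n)) (sym (+-suc-suc m n)) ⟩
          twist m (2 ℕ.+ n) * v m * w (m ℕ.+ (2 ℕ.+ n))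
            ≡⟨ pf[m] (2 ℕ.+ n) ⟩
          w (m ℕ.+ (m ℕ.+ (2 ℕ.+ n))) + t * w (2 ℕ.+ n)
            ≡⟨ cong (λ i → w i + t * w (2 ℕ.+ n))
                    (trans (cong (m ℕ.+_) (+-suc-suc m n)) (+-suc-suc m (m ℕ.+ n))) ⟩
          w₂ + t * w (2 ℕ.+ n) ∎
        IH₁ : twist′ * v′ * W ≡ w₃ + (- C) * t * w (1 ℕ.+ n)
        IH₁ = begin
          twist′ * v′ * W
            ≡⟨ cong (λ i → twist′ * v′ * w (suc i)) (sym (+-suc m n)) ⟩
          twist′ * v′ * w (1 ℕ.+ m ℕ.+ (1 ℕ.+ n))
            ≡⟨ pf[1+m] (suc n) ⟩
          w (1 ℕ.+ m ℕ.+ (1 ℕ.+ m ℕ.+ (1 ℕ.+ n))) + (- C) * t * w (1 ℕ.+ n)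
            ≡⟨ cong (λ i → w (suc i) + (- C) * t * w (1 ℕ.+ n))
                    (trans (cong (λ i → m ℕ.+ suc i) (+-suc m n)) (+-suc-suc m (m ℕ.+ n))) ⟩
          w₃ + (- C) * t * w (1 ℕ.+ n) ∎
        w[4+K] : w (4 ℕ.+ K) ≡ coeff n * w₃ + C * w₂
        w[4+K] = trans (seqW-suc-suc w0 w1 (2 ℕ.+ K))
          (cong (λ i → pick i (ℕ→ℚ a) (ℕ→ℚ b) * w₃ + C * w₂) (trans (ξ-suc-suc K) (ξ-+-double m n)))

      product-formula : ∀ m → ProductFormula m
      product-formula zero          = product-formula-zero
      product-formula (suc zero)    = product-formula-one
      product-formula (suc (suc m)) = product-formula-step m (product-formula m) (product-formula (suc m))

      four-term-identity : ∀ n m r →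
        - (- C) ^ (m ℕ.+ r) * w n + (- C) ^ m * twist r n * v r * w (r ℕ.+ n)
          + w (2 ℕ.* (m ℕ.+ r) ℕ.+ n)
        ≡ twist m n * v m * w (m ℕ.+ 2 ℕ.* r ℕ.+ n)
      four-term-identity n m r = begin
        - (- C) ^ (m ℕ.+ r) * w n + tₘ * twist r n * v r * w (r ℕ.+ n) + w (2 ℕ.* (m ℕ.+ r) ℕ.+ n)
          ≡⟨ cong₂ (λ x i → - x * w n + tₘ * twist r n * v r * w (r ℕ.+ n) + w i)
                   (^-homo-* (- C) m r) (index-left m r n) ⟩
        - (tₘ * tᵣ) * w n + tₘ * twist r n * v r * w (r ℕ.+ n) + w (m ℕ.+ (m ℕ.+ R))
          ≡⟨ cong (λ x → - (tₘ * tᵣ) * w n + x + w (m ℕ.+ (m ℕ.+ R)))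
                  (solve 4 (λ t s u x → t :* s :* u :* x := t :* (s :* u :* x))
                     refl tₘ (twist r n) (v r) (w (r ℕ.+ n))) ⟩
        - (tₘ * tᵣ) * w n + tₘ * (twist r n * v r * w (r ℕ.+ n)) + w (m ℕ.+ (m ℕ.+ R))
          ≡⟨ cong (λ x → - (tₘ * tᵣ) * w n + tₘ * x + w (m ℕ.+ (m ℕ.+ R))) (product-formula r n) ⟩
        - (tₘ * tᵣ) * w n + tₘ * (w R + tᵣ * w n) + w (m ℕ.+ (m ℕ.+ R))
          ≡⟨ solve 5 (λ t s x y z → :- (t :* s) :* x :+ t :* (y :+ s :* x) :+ z := z :+ t :* y)
               refl tₘ tᵣ (w n) (w R) (w (m ℕ.+ (m ℕ.+ R))) ⟩
        w (m ℕ.+ (m ℕ.+ R)) + tₘ * w R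
          ≡⟨ sym (product-formula m R) ⟩
        twist m R * v m * w (m ℕ.+ R)
          ≡⟨ cong₂ (λ x i → x * v m * w i) (twist-+-doubleʳ m r n) (sym (index-right m r n)) ⟩
        twist m n * v m * w (m ℕ.+ 2 ℕ.* r ℕ.+ n) ∎
        where
        open ≡-Reasoning
        tₘ = (- C) ^ m
        tᵣ = (- C) ^ r
        R = r ℕ.+ (r ℕ.+ n)
        index-left : ∀ m r n → 2 ℕ.* (m ℕ.+ r) ℕ.+ n ≡ m ℕ.+ (m ℕ.+ (r ℕ.+ (r ℕ.+ n)))
        index-left = solve-∀
        index-right : ∀ m r n → m ℕ.+ 2 ℕ.* r ℕ.+ n ≡ m ℕ.+ (r ℕ.+ (r ℕ.+ n))
        index-right = solve-∀

theorem4 : (a b c : ℕ) → {{_ : NonZero a}} → {{_ : NonZero b}} → {{_ : NonZero c}} →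
    (w0 w1 : ℚ) → (n m r : ℕ) → 0 < n → 0 < m → 0 < r →
    let w = seqW a b c w0 w1
        v = seqW a b c (ℕ→ℚ 2) (ℕ→ℚ b)
        mc = - ℕ→ℚ c
        ab = + a / b
    in - (mc ^ (m Data.Nat.+ r)) * w n
       + (mc ^ m) * (ab ^ (ξ r Data.Nat.* ξ (suc n))) * v r * w (r Data.Nat.+ n)
       + w (2 Data.Nat.* (m Data.Nat.+ r) Data.Nat.+ n)
       ≡ (ab ^ (ξ m Data.Nat.* ξ (suc n))) * v m * w (m Data.Nat.+ 2 Data.Nat.* r Data.Nat.+ n)
theorem4 a b c w0 w1 n m r _ _ _ = four-term-identity a b c w0 w1 n m r
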